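{- Let $G$ be a finite simple graph and $\mathbf{x}$ a solvable configuration on $G$. Then $\mathbf{x}\cdot\mathbf{p}=0$ for every solving pattern $\mathbf{p}$ for $\overline{\mathbf{x}}=\mathbf{x}+\mathbf{1}$.
   Context: For $G$ with vertex set $\{v_1,\dots,v_n\}$, $N=N(G)$ is the closed neighborhood matrix over $\mathbb{Z}_2$ (entry $(i,j)$ is $1$ iff $i=j$ or $v_iv_j$ is an edge). $\mathbf{1}$ is the all-ones vector, $\overline{\mathbf{x}}:=\mathbf{x}+\mathbf{1}$, and $\mathbf{x}\cdot\mathbf{y}=\mathbf{x}^t\mathbf{y}$ over $\mathbb{Z}_2$. A pattern $\mathbf{p}$ solves configuration $\mathbf{c}$ if $N\mathbf{p}=\mathbf{c}$; $\mathbf{c}$ is solvable if some pattern solves it. (Every graph has a solution of $N\mathbf{s}=\mathbf{1}$, so $\overline{\mathbf{x}}$ is solvable whenever $\mathbf{x}$ is.) -}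

module Defs where

open import Data.Nat using (ℕ)
open import Data.Fin using (Fin)
open import Data.Bool using (Bool; true; false; _xor_; _∧_; not)
open import Data.Fin.Properties using (_≟_)
open import Relation.Nullary using (¬_; yes; no)
open import Relation.Binary.PropositionalEquality using (_≡_)
open import Data.Product using (Σ; ∃)

-- ℤ₂ is represented by Bool: addition = xor, multiplication = ∧.

record Graph (n : ℕ) : Set where
  field
    adj     : Fin n → Fin n → Bool
    symm    : ∀ i j → adj i j ≡ adj j i
    irrefl  : ∀ i → adj i i ≡ false

Vec₂ : ℕ → Set
Vec₂ n = Fin n → Bool

Σ₂ : ∀ {n} → (Fin n → Bool) → Bool
Σ₂ {ℕ.zero}  f = false
Σ₂ {ℕ.suc n} f = f Fin.zero xor Σ₂ (λ i → f (Fin.suc i))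

N : ∀ {n} → Graph n → Fin n → Fin n → Bool
N G i j with i ≟ j
... | yes _ = true
... | no  _ = Graph.adj G i j

_·ᴹ_ : ∀ {n} → (Fin n → Fin n → Bool) → Vec₂ n → Vec₂ n
(M ·ᴹ p) i = Σ₂ (λ j → M i j ∧ p j)

_·_ : ∀ {n} → Vec₂ n → Vec₂ n → Bool
x · y = Σ₂ (λ i → x i ∧ y i)

𝟏 : ∀ {n} → Vec₂ n
𝟏 _ = true

‾ : ∀ {n} → Vec₂ n → Vec₂ n
‾ x i = x i xor true

Solves : ∀ {n} → Graph n → Vec₂ n → Vec₂ n → Set
Solves G p c = ∀ i → (N G ·ᴹ p) i ≡ c i

Solvable : ∀ {n} → Graph n → Vec₂ n → Set
Solvable {n} G c = Σ (Vec₂ n) (λ p → Solves G p c)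

-- Over ℤ₂ the quadratic form qᵀMq of a symmetric matrix M with unit diagonal
-- equals Σ qᵢ, because the off-diagonal terms cancel in pairs. If x = Nq and
-- Np = x + 1, then, N being symmetric, x·p = q·(Np) = q·x + q·1 = qᵀNq + Σ qᵢ,
-- which is twice Σ qᵢ, i.e. zero.
module Submission where

open import Algebra.Bundles using (CommutativeMonoid; CommutativeRing)
import Algebra.Properties.CommutativeSemigroup as CommutativeSemigroupProperties
open import Data.Bool using (Bool; true; false; _xor_; _∧_)
open import Data.Bool.Properties
  using ( ∧-commutativeMonoid; xor-∧-commutativeRing; ∧-comm; ∧-identityʳ
        ; ∧-distribˡ-xor; xor-assoc; xor-same )
open import Data.Fin using (Fin; zero; suc)
open import Data.Fin.Properties using (_≟_)
open import Data.Nat using (ℕ)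
open import Data.Product using (_,_)
open import Function using (_∘_)
open import Relation.Nullary using (yes; no; contradiction)
open import Relation.Binary.PropositionalEquality
  using (_≡_; refl; sym; cong; cong₂; module ≡-Reasoning)
open ≡-Reasoning

open import Defs

private
  module ∧ = CommutativeSemigroupProperties
    (CommutativeMonoid.commutativeSemigroup ∧-commutativeMonoid)
  module ⊕ = CommutativeSemigroupProperties
    (CommutativeRing.+-commutativeSemigroup xor-∧-commutativeRing)

xor-cancel-middle : ∀ a b c → (a xor b) xor (b xor c) ≡ a xor c
xor-cancel-middle a b c = begin
  (a xor b) xor (b xor c)  ≡⟨ xor-assoc a b (b xor c) ⟩
  a xor (b xor (b xor c))  ≡⟨ cong (a xor_) (xor-assoc b b c) ⟨
  a xor ((b xor b) xor c)  ≡⟨ cong (λ z → a xor (z xor c)) (xor-same b) ⟩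
  a xor c                  ∎

Σ₂-cong : ∀ {n} {f g : Fin n → Bool} → (∀ i → f i ≡ g i) → Σ₂ f ≡ Σ₂ g
Σ₂-cong {ℕ.zero}  f≡g = refl
Σ₂-cong {ℕ.suc n} f≡g = cong₂ _xor_ (f≡g zero) (Σ₂-cong (f≡g ∘ suc))

Σ₂-false : ∀ n → Σ₂ {n} (λ _ → false) ≡ false
Σ₂-false ℕ.zero    = refl
Σ₂-false (ℕ.suc n) = Σ₂-false n

Σ₂-xor : ∀ {n} (f g : Fin n → Bool) →
         Σ₂ (λ i → f i xor g i) ≡ Σ₂ f xor Σ₂ g
Σ₂-xor {ℕ.zero}  f g = refl
Σ₂-xor {ℕ.suc n} f g = begin
  (f zero xor g zero) xor Σ₂ (λ i → f (suc i) xor g (suc i))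
    ≡⟨ cong ((f zero xor g zero) xor_) (Σ₂-xor (f ∘ suc) (g ∘ suc)) ⟩
  (f zero xor g zero) xor (Σ₂ (f ∘ suc) xor Σ₂ (g ∘ suc))
    ≡⟨ ⊕.interchange (f zero) (g zero) _ _ ⟩
  Σ₂ f xor Σ₂ g
    ∎

Σ₂-∧ˡ : ∀ {n} a (f : Fin n → Bool) → Σ₂ (λ i → a ∧ f i) ≡ a ∧ Σ₂ f
Σ₂-∧ˡ {ℕ.zero}  false f = refl
Σ₂-∧ˡ {ℕ.zero}  true  f = refl
Σ₂-∧ˡ {ℕ.suc n} a     f = begin
  (a ∧ f zero) xor Σ₂ (λ i → a ∧ f (suc i))  ≡⟨ cong ((a ∧ f zero) xor_) (Σ₂-∧ˡ a (f ∘ suc)) ⟩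
  (a ∧ f zero) xor (a ∧ Σ₂ (f ∘ suc))        ≡⟨ ∧-distribˡ-xor a (f zero) _ ⟨
  a ∧ Σ₂ f                                   ∎

Σ₂-swap : ∀ {m n} (f : Fin m → Fin n → Bool) →
          Σ₂ (λ i → Σ₂ (f i)) ≡ Σ₂ (λ j → Σ₂ (λ i → f i j))
Σ₂-swap {ℕ.zero}  {n} f = sym (Σ₂-false n)
Σ₂-swap {ℕ.suc m}     f = begin
  Σ₂ (f zero) xor Σ₂ (λ i → Σ₂ (f (suc i)))
    ≡⟨ cong (Σ₂ (f zero) xor_) (Σ₂-swap (f ∘ suc)) ⟩
  Σ₂ (f zero) xor Σ₂ (λ j → Σ₂ (λ i → f (suc i) j))
    ≡⟨ Σ₂-xor (f zero) (λ j → Σ₂ (λ i → f (suc i) j)) ⟨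
  Σ₂ (λ j → Σ₂ (λ i → f i j))
    ∎

-- In characteristic 2 the terms f i j and f j i with i ≠ j cancel.
Σ₂-Σ₂-symmetric≡Σ₂-diagonal : ∀ {n} (f : Fin n → Fin n → Bool) →
  (∀ i j → f i j ≡ f j i) → Σ₂ (λ i → Σ₂ (f i)) ≡ Σ₂ (λ i → f i i)
Σ₂-Σ₂-symmetric≡Σ₂-diagonal {ℕ.zero}  f sym-f = refl
Σ₂-Σ₂-symmetric≡Σ₂-diagonal {ℕ.suc n} f sym-f = begin
  (f zero zero xor row) xor Σ₂ (λ i → f (suc i) zero xor Σ₂ (f (suc i) ∘ suc))
    ≡⟨ cong ((f zero zero xor row) xor_) (Σ₂-xor (λ i → f (suc i) zero) _) ⟩
  (f zero zero xor row) xor (Σ₂ (λ i → f (suc i) zero) xor rest)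
    ≡⟨ cong (λ column → (f zero zero xor row) xor (column xor rest))
            (Σ₂-cong (λ i → sym-f (suc i) zero)) ⟩
  (f zero zero xor row) xor (row xor rest)
    ≡⟨ xor-cancel-middle (f zero zero) row rest ⟩
  f zero zero xor rest
    ≡⟨ cong (f zero zero xor_)
            (Σ₂-Σ₂-symmetric≡Σ₂-diagonal (λ i j → f (suc i) (suc j)) (λ i j → sym-f (suc i) (suc j))) ⟩
  Σ₂ (λ i → f i i)
    ∎
  where
  row  = Σ₂ (f zero ∘ suc)
  rest = Σ₂ (λ i → Σ₂ (f (suc i) ∘ suc))

·-cong : ∀ {n} {x x′ y y′ : Vec₂ n} →
         (∀ i → x i ≡ x′ i) → (∀ i → y i ≡ y′ i) → x · y ≡ x′ · y′
·-cong x≡x′ y≡y′ = Σ₂-cong (λ i → cong₂ _∧_ (x≡x′ i) (y≡y′ i))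

·-comm : ∀ {n} (x y : Vec₂ n) → x · y ≡ y · x
·-comm x y = Σ₂-cong (λ i → ∧-comm (x i) (y i))

·-‾ʳ : ∀ {n} (q x : Vec₂ n) → q · ‾ x ≡ q · x xor Σ₂ q
·-‾ʳ q x = begin
  Σ₂ (λ i → q i ∧ (x i xor true))         ≡⟨ Σ₂-cong (λ i → ∧-distribˡ-xor (q i) (x i) true) ⟩
  Σ₂ (λ i → (q i ∧ x i) xor (q i ∧ true))  ≡⟨ Σ₂-xor (λ i → q i ∧ x i) _ ⟩
  q · x xor Σ₂ (λ i → q i ∧ true)          ≡⟨ cong (q · x xor_) (Σ₂-cong (∧-identityʳ ∘ q)) ⟩
  q · x xor Σ₂ q                           ∎

·-·ᴹ-expand : ∀ {n} (q : Vec₂ n) (M : Fin n → Fin n → Bool) (p : Vec₂ n) →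
              q · (M ·ᴹ p) ≡ Σ₂ (λ i → Σ₂ (λ j → q i ∧ M i j ∧ p j))
·-·ᴹ-expand q M p = sym (Σ₂-cong (λ i → Σ₂-∧ˡ (q i) (λ j → M i j ∧ p j)))

·ᴹ-selfAdjoint : ∀ {n} (M : Fin n → Fin n → Bool) → (∀ i j → M i j ≡ M j i) →
                 (q p : Vec₂ n) → (M ·ᴹ q) · p ≡ q · (M ·ᴹ p)
·ᴹ-selfAdjoint M sym-M q p = begin
  (M ·ᴹ q) · p                                 ≡⟨ ·-comm (M ·ᴹ q) p ⟩
  p · (M ·ᴹ q)                                 ≡⟨ ·-·ᴹ-expand p M q ⟩
  Σ₂ (λ i → Σ₂ (λ j → p i ∧ M i j ∧ q j))      ≡⟨ Σ₂-swap (λ i j → p i ∧ M i j ∧ q j) ⟩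
  Σ₂ (λ j → Σ₂ (λ i → p i ∧ M i j ∧ q j))      ≡⟨ Σ₂-cong (λ j → Σ₂-cong (λ i → reverse (p i) (q j) (sym-M i j))) ⟩
  Σ₂ (λ j → Σ₂ (λ i → q j ∧ M j i ∧ p i))      ≡⟨ ·-·ᴹ-expand q M p ⟨
  q · (M ·ᴹ p)                                 ∎
  where
  reverse : ∀ a c {b b′} → b ≡ b′ → a ∧ b ∧ c ≡ c ∧ b′ ∧ a
  reverse a c refl = ∧.x∙yz≈z∙yx a _ c

quadraticForm-unitDiagonal : ∀ {n} (M : Fin n → Fin n → Bool) →
  (∀ i j → M i j ≡ M j i) → (∀ i → M i i ≡ true) →
  (q : Vec₂ n) → q · (M ·ᴹ q) ≡ Σ₂ q
quadraticForm-unitDiagonal M sym-M diag-M q = begin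
  q · (M ·ᴹ q)                              ≡⟨ ·-·ᴹ-expand q M q ⟩
  Σ₂ (λ i → Σ₂ (λ j → q i ∧ M i j ∧ q j))   ≡⟨ Σ₂-Σ₂-symmetric≡Σ₂-diagonal _ term-symmetric ⟩
  Σ₂ (λ i → q i ∧ M i i ∧ q i)              ≡⟨ Σ₂-cong diagonal-term ⟩
  Σ₂ q                                      ∎
  where
  term-symmetric : ∀ i j → q i ∧ M i j ∧ q j ≡ q j ∧ M j i ∧ q i
  term-symmetric i j rewrite sym-M i j = ∧.x∙yz≈z∙yx (q i) (M j i) (q j)
  diagonal-term : ∀ i → q i ∧ M i i ∧ q i ≡ q i
  diagonal-term i rewrite diag-M i with q i
  ... | false = refl
  ... | true  = refl

N-symmetric : ∀ {n} (G : Graph n) i j → N G i j ≡ N G j i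
N-symmetric G i j with i ≟ j | j ≟ i
... | yes _   | yes _   = refl
... | yes i≡j | no  j≢i = contradiction (sym i≡j) j≢i
... | no  i≢j | yes j≡i = contradiction (sym j≡i) i≢j
... | no  _   | no  _   = Graph.symm G i j

N-diagonal : ∀ {n} (G : Graph n) i → N G i i ≡ true
N-diagonal G i with i ≟ i
... | yes _   = refl
... | no  i≢i = contradiction refl i≢i

mainTheorem6 : (n : ℕ) (G : Graph n) (x : Vec₂ n) → Solvable G x →
    (p : Vec₂ n) → Solves G p (‾ x) → x · p ≡ false
mainTheorem6 n G x (q , Nq≡x) p Np≡‾x = begin
  x · p                          ≡⟨ ·-cong (sym ∘ Nq≡x) (λ _ → refl) ⟩
  (N G ·ᴹ q) · p                 ≡⟨ ·ᴹ-selfAdjoint (N G) (N-symmetric G) q p ⟩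
  q · (N G ·ᴹ p)                 ≡⟨ ·-cong (λ _ → refl) Np≡‾x ⟩
  q · ‾ x                        ≡⟨ ·-‾ʳ q x ⟩
  q · x xor Σ₂ q                 ≡⟨ cong (_xor Σ₂ q) (·-cong (λ _ → refl) (sym ∘ Nq≡x)) ⟩
  q · (N G ·ᴹ q) xor Σ₂ q        ≡⟨ cong (_xor Σ₂ q) (quadraticForm-unitDiagonal (N G) (N-symmetric G) (N-diagonal G) q) ⟩
  Σ₂ q xor Σ₂ q                  ≡⟨ xor-same (Σ₂ q) ⟩
  false                          ∎
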